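{- The tableau procedure $\mathtt{TAB}_{\mathcal{ALC}\iota}$ is terminating: for every input $\mathcal{ALC}\iota$ concept $C$ (and optional $\mathcal{ALC}\iota$ ontology $\mathcal{O}$), the tableau constructed by exhaustively applying its rules is finite.
   Context: $\mathcal{ALC}\iota$ concepts: $C ::= A \mid \neg C \mid (C\sqcap C) \mid \exists r.C \mid \{\iota C\} \mid \iota C.C$. An ontology consists of a TBox (concept inclusions) and an ABox (assertions $a:C$, $r:(a,b)$). Procedure $\mathtt{TAB}_{\mathcal{ALC}\iota}$: builds a tree of assertions whose root contains $a:C$, $a$ not in $\mathcal{O}$. A branch (root-to-leaf path, treated as a set of assertions) is closed if it contains $\bot$, open otherwise. A rule $\frac{Pr}{Con_1\mid\cdots\mid Con_m}$ is applicable to $Pr$ if not blocked, no $Con_i$ is already on the branch, and the branch is open; applying it splits the branch into $m$ extensions. Rules are applied in fixed priority order ($(\bot)$ highest, $(\exists r)$ lowest). Rules ($b,b'$ fresh individuals; $A^g_C$, $A_C$ fresh atomic concepts determined by $C$): $(ABox_{\mathsf I})$: if $a:C\in$ABox add $a:C$; $(ABox_r)$: if $r(a,a')\in$ABox add $r(a,a')$; $(TBox)$: from $C\sqsubseteq D\in$TBox and $a:E$ add $a:\neg(C\sqcap\neg D)$; $(\bot)$: $a:C,a:\neg C\Rightarrow\bot$; $(\neg\neg)$: $a:\neg\neg C\Rightarrow a:C$; $(\sqcap)$: $a:C\sqcap D\Rightarrow a:C,a:D$; $(\neg\sqcap)$: $a:\neg(C\sqcap D)\Rightarrow a:\neg C\mid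 a:\neg D$; $(\exists r)$: $a:\exists r.C\Rightarrow b:C,r:(a,b)$, blocked if some individual $a'$ on the branch has $a':C$ and $a':\neg D$ for every $D$ with $a:\neg\exists r.D$ on the branch; $(\neg\exists r)$: $a:\neg\exists r.C,r:(a,a')\Rightarrow a':\neg C$; $(\iota^g_1)$: $a:\iota C.D\Rightarrow b:C,b:D$, except that if some individual already satisfies $C$ only $D$ is added to the lexicographically least such; $(\iota^g_2)$: $a:\iota C.D,a':C,a'':C,a':E\Rightarrow a'':E$; $(\neg\iota^g)$: $a:\neg\iota C.D,a':E\Rightarrow a':\neg C\mid a':\neg D\mid b:C,b:A^g_C,b':C,b':\neg A^g_C$, and once the third alternative has been taken further applications to $x:\neg\iota C.E$ are blocked; $(cut^g_\iota)$: $a:\iota C.D,a':E\Rightarrow a':C\mid a':\neg C$; $(\iota^\ell_1)$: $a:\{\iota C\}\Rightarrow a:C$; $(\iota^\ell_2)$: $a:\{\iota C\},a':C,a'':C,a':D\Rightarrow a'':D$; $(\neg\iota^\ell)$: $a:\neg\{\iota C\}\Rightarrow a:\neg C\mid a:\neg A_C,b:C,b:A_C$ (in the right alternative only $a:\neg A_C$ is added if an individual already satisfies $C$ and $A_C$); $(cut^\ell_\iota)$: $a:\{\iota C\},a':D\Rightarrow a':C\mid a':\neg C$. -}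

module Defs where

open import Data.Nat using (ℕ; _≤_; _<_)
open import Data.Product using (Σ; _×_; _,_; proj₁)
open import Data.Sum using (_⊎_)
open import Data.Unit using (⊤)
open import Data.Empty using (⊥)
open import Data.List using (List; []; _∷_; _++_)
open import Data.List.Relation.Unary.All using (All)
open import Data.List.Relation.Unary.Any using (Any)
open import Data.List.Membership.Propositional using (_∈_)
open import Relation.Nullary using (¬_)
open import Relation.Binary.PropositionalEquality using (_≡_; _≢_)
open import Induction.WellFounded using (Acc)

-- Individual names and role names are natural numbers (individuals are
-- ordered by the usual order on ℕ, playing the role of the
-- "lexicographic" order of the paper).
Ind : Set
Ind = ℕ

Role : Set
Role = ℕ

mutual
  -- Atomic concepts: the user's atomic concepts (base n), and the fresh
  -- atomic concepts A^g_C (gen C) and A_C (loc C) determined by C,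
  -- used only by the rules (¬ι^g) and (¬ι^ℓ).
  data Atom : Set where
    base : ℕ → Atom
    gen  : Concept → Atom
    loc  : Concept → Atom

  data Concept : Set where
    atm  : Atom → Concept
    neg  : Concept → Concept
    _⊓_  : Concept → Concept → Concept
    ex   : Role → Concept → Concept
    ιl   : Concept → Concept
    ιg   : Concept → Concept → Concept

PureC : Concept → Set
PureC (atm (base _)) = ⊤
PureC (atm (gen _))  = ⊥
PureC (atm (loc _))  = ⊥
PureC (neg C)        = PureC C
PureC (C ⊓ D)        = PureC C × PureC D
PureC (ex _ C)       = PureC C
PureC (ιl C)         = PureC C
PureC (ιg C D)       = PureC C × PureC D

record Ontology : Set where
  field
    TBox   : List (Concept × Concept)
    ABoxC  : List (Ind × Concept)
    ABoxR  : List (Role × Ind × Ind)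
open Ontology public

PureO : Ontology → Set
PureO O = All (λ p → PureC (Data.Product.proj₁ p) × PureC (Data.Product.proj₂ p)) (TBox O)
        × All (λ p → PureC (Data.Product.proj₂ p)) (ABoxC O)

OccursO : Ind → Ontology → Set
OccursO a O = Any (λ p → proj₁ p ≡ a) (ABoxC O)
            ⊎ Any (λ p → (proj₁ (Data.Product.proj₂ p) ≡ a)
                         ⊎ (Data.Product.proj₂ (Data.Product.proj₂ p) ≡ a)) (ABoxR O)

infix 6 _∶_
data Assertion : Set where
  _∶_ : Ind → Concept → Assertion
  rel : Role → Ind → Ind → Assertion
  ⊥ₐ  : Assertion

-- a branch (root-to-leaf path), used through membership only (a set)
Branch : Set
Branch = List Assertion

Occ : Ind → Assertion → Set
Occ b (x ∶ _)     = b ≡ x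
Occ b (rel _ x y) = b ≡ x ⊎ b ≡ y
Occ b ⊥ₐ          = ⊥

FreshI : Ontology → Branch → Ind → Set
FreshI O B b = ¬ Any (Occ b) B × ¬ OccursO b O

_⊆_ : List Assertion → Branch → Set
Con ⊆ B = All (_∈ B) Con

data Rule : Set where
  R⊥ RABoxI RABoxR RTBox R¬¬ R⊓ R¬⊓ R¬∃ Rιg1 Rιg2 R¬ιg Rcutg
    Rιl1 Rιl2 R¬ιl Rcutl R∃ : Rule

-- fixed priority order: smaller rank = higher priority;
-- (⊥) highest, (∃r) lowest.
rank : Rule → ℕ
rank R⊥     = 0
rank RABoxI = 1
rank RABoxR = 2
rank RTBox  = 3
rank R¬¬    = 4
rank R⊓     = 5
rank R¬⊓    = 6
rank R¬∃    = 7
rank Rιg1   = 8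
rank Rιg2   = 9
rank R¬ιg   = 10
rank Rcutg  = 11
rank Rιl1   = 12
rank Rιl2   = 13
rank R¬ιl   = 14
rank Rcutl  = 15
rank R∃     = 16

∃Blocked : Branch → Ind → Role → Concept → Set
∃Blocked B a r C =
  Σ Ind λ a' → (a' ∶ C) ∈ B × (∀ D → (a ∶ neg (ex r D)) ∈ B → (a' ∶ neg D) ∈ B)

-- (¬ι^g) for x:¬ιC.E is blocked once its third alternative has been taken
-- for C, i.e. once the fresh concept A^g_C occurs on the branch.
¬ιgBlocked : Branch → Concept → Set
¬ιgBlocked B C = Σ Ind λ x → (x ∶ atm (gen C)) ∈ B

LeastSat : Branch → Concept → Ind → Set
LeastSat B C m = (m ∶ C) ∈ B × (∀ x → (x ∶ C) ∈ B → m ≤ x)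

-- Instances of rules: App O B r Cs means that rule r has an instance on
-- branch B (premises on B, not blocked) with conclusions Cs = Con₁ | ... | Conₘ.
data App (O : Ontology) (B : Branch) : Rule → List (List Assertion) → Set where
  aboxI : ∀ {a C} → (a , C) ∈ ABoxC O →
          App O B RABoxI ((a ∶ C ∷ []) ∷ [])
  aboxR : ∀ {r a a'} → (r , a , a') ∈ ABoxR O →
          App O B RABoxR ((rel r a a' ∷ []) ∷ [])
  tbox  : ∀ {C D a E} → (C , D) ∈ TBox O → (a ∶ E) ∈ B →
          App O B RTBox ((a ∶ neg (C ⊓ neg D) ∷ []) ∷ [])
  bot   : ∀ {a C} → (a ∶ C) ∈ B → (a ∶ neg C) ∈ B →
          App O B R⊥ ((⊥ₐ ∷ []) ∷ [])
  negneg : ∀ {a C} → (a ∶ neg (neg C)) ∈ B →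
          App O B R¬¬ ((a ∶ C ∷ []) ∷ [])
  and   : ∀ {a C D} → (a ∶ (C ⊓ D)) ∈ B →
          App O B R⊓ ((a ∶ C ∷ a ∶ D ∷ []) ∷ [])
  nand  : ∀ {a C D} → (a ∶ neg (C ⊓ D)) ∈ B →
          App O B R¬⊓ ((a ∶ neg C ∷ []) ∷ (a ∶ neg D ∷ []) ∷ [])
  exR   : ∀ {a r C b} → (a ∶ ex r C) ∈ B → FreshI O B b →
          ¬ ∃Blocked B a r C →
          App O B R∃ ((b ∶ C ∷ rel r a b ∷ []) ∷ [])
  nex   : ∀ {a a' r C} → (a ∶ neg (ex r C)) ∈ B → rel r a a' ∈ B →
          App O B R¬∃ ((a' ∶ neg C ∷ []) ∷ [])
  ιg1-new : ∀ {a C D b} → (a ∶ ιg C D) ∈ B → (∀ x → ¬ (x ∶ C) ∈ B) →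
          FreshI O B b →
          App O B Rιg1 ((b ∶ C ∷ b ∶ D ∷ []) ∷ [])
  ιg1-old : ∀ {a C D m} → (a ∶ ιg C D) ∈ B → LeastSat B C m →
          App O B Rιg1 ((m ∶ D ∷ []) ∷ [])
  ιg2   : ∀ {a a' a'' C D E} → (a ∶ ιg C D) ∈ B → (a' ∶ C) ∈ B →
          (a'' ∶ C) ∈ B → (a' ∶ E) ∈ B →
          App O B Rιg2 ((a'' ∶ E ∷ []) ∷ [])
  nιg   : ∀ {a a' C D E b b'} → (a ∶ neg (ιg C D)) ∈ B → (a' ∶ E) ∈ B →
          ¬ ¬ιgBlocked B C → FreshI O B b → FreshI O B b' → b ≢ b' →
          App O B R¬ιg ((a' ∶ neg C ∷ []) ∷ (a' ∶ neg D ∷ [])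
                        ∷ (b ∶ C ∷ b ∶ atm (gen C) ∷ b' ∶ C ∷ b' ∶ neg (atm (gen C)) ∷ [])
                        ∷ [])
  cutg  : ∀ {a a' C D E} → (a ∶ ιg C D) ∈ B → (a' ∶ E) ∈ B →
          App O B Rcutg ((a' ∶ C ∷ []) ∷ (a' ∶ neg C ∷ []) ∷ [])
  ιl1   : ∀ {a C} → (a ∶ ιl C) ∈ B →
          App O B Rιl1 ((a ∶ C ∷ []) ∷ [])
  ιl2   : ∀ {a a' a'' C D} → (a ∶ ιl C) ∈ B → (a' ∶ C) ∈ B →
          (a'' ∶ C) ∈ B → (a' ∶ D) ∈ B →
          App O B Rιl2 ((a'' ∶ D ∷ []) ∷ [])
  nιl-new : ∀ {a C b} → (a ∶ neg (ιl C)) ∈ B →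
          ¬ (Σ Ind λ x → (x ∶ C) ∈ B × (x ∶ atm (loc C)) ∈ B) →
          FreshI O B b →
          App O B R¬ιl ((a ∶ neg C ∷ [])
                        ∷ (a ∶ neg (atm (loc C)) ∷ b ∶ C ∷ b ∶ atm (loc C) ∷ []) ∷ [])
  nιl-old : ∀ {a C x} → (a ∶ neg (ιl C)) ∈ B →
          (x ∶ C) ∈ B → (x ∶ atm (loc C)) ∈ B →
          App O B R¬ιl ((a ∶ neg C ∷ []) ∷ (a ∶ neg (atm (loc C)) ∷ []) ∷ [])
  cutl  : ∀ {a a' C D} → (a ∶ ιl C) ∈ B → (a' ∶ D) ∈ B →
          App O B Rcutl ((a' ∶ C ∷ []) ∷ (a' ∶ neg C ∷ []) ∷ [])

Applicable : Ontology → Branch → Rule → List (List Assertion) → Set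
Applicable O B r Cs = App O B r Cs × ¬ (⊥ₐ ∈ B) × All (λ Con → ¬ (Con ⊆ B)) Cs

Step : Ontology → Branch → Branch → Set
Step O B B' =
  Σ Rule λ r → Σ (List (List Assertion)) λ Cs →
    Applicable O B r Cs
    × (∀ r' Cs' → rank r' < rank r → ¬ Applicable O B r' Cs')
    × Any (λ Con → B' ≡ Con ++ B) Cs

_⟵[_]_ : Branch → Ontology → Branch → Set
B' ⟵[ O ] B = Step O B B'

-- TAB terminates on input C (with ontology O) started with root a:C:
-- every sequence of rule applications from the root is finite, i.e. the
-- (finitely branching) tableau is finite.
Terminates : Ontology → Ind → Concept → Set
Terminates O a C = Acc (λ B' B → B' ⟵[ O ] B) (a ∶ C ∷ [])

{-# OPTIONS --safe #-}
module Submission where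

-- Every concept written on a branch is admissible: a subconcept of the
-- input concept or of the ontology, the negation of one, or a marker
-- A^g_C, A_C or its negation for such a C; these form a finite set.  A
-- step either adds an assertion about individuals already present (or
-- named in the ABox), drawn from a set that is finite once those
-- individuals are fixed, or it introduces fresh individuals and thereby
-- makes a new key hold: (ι^g_1) makes C inhabited, (¬ι^g) makes A^g_C
-- inhabited, (¬ι^ℓ) makes C ⊓ A_C inhabited, and (∃r) on a:∃r.C creates
-- the first individual with C excluding every D with a:¬∃r.D (an earlier
-- one would block the rule).  Keys range over a finite set and keep
-- holding once they hold, so there are finitely many steps of the second
-- kind and finitely many of the first kind between two of them.

open import Defs hiding (_⊆_)
open import Data.Bool using (true; false)
open import Data.Empty using (⊥; ⊥-elim)
open import Data.List using (List; []; _∷_; _++_; map; concatMap; filter; cartesianProductWith)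
open import Data.List.Membership.Propositional using (_∈_; find; lose)
open import Data.List.Membership.Propositional.Properties
  using (∈-++⁺ˡ; ∈-++⁺ʳ; ∈-++⁻; ∈-map⁺; ∈-concatMap⁺; ∈-cartesianProductWith⁺; ∈-filter⁺; ∈-filter⁻)
open import Data.List.Relation.Binary.Subset.Propositional using (_⊆_)
open import Data.List.Relation.Binary.Subset.Propositional.Properties
  using (⊆-refl; ⊆-trans; xs⊆ys++xs)
open import Data.List.Relation.Unary.All as All using (All; []; _∷_)
import Data.List.Relation.Unary.All.Properties as Allₚ
open import Data.List.Relation.Unary.Any as Any using (Any; here; there)
import Data.List.Relation.Unary.Any.Properties as Anyₚ
open import Data.Nat using (ℕ; _<_; _<?_) renaming (_≟_ to _≟ℕ_)
open import Data.Product using (Σ; _×_; _,_; proj₁; proj₂; uncurry)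
open import Data.Sum as Sum using (_⊎_; inj₁; inj₂)
open import Data.Unit using (⊤; tt)
open import Function using (_∘_)
open import Induction.WellFounded using (Acc; acc; WellFounded)
open import Relation.Binary.Definitions using (DecidableEquality)
open import Relation.Binary.PropositionalEquality using (_≡_; refl; sym; cong; cong₂)
open import Relation.Nullary using (¬_; Dec; yes; no; does)
open import Relation.Nullary.Decidable using (map′; _×-dec_; decidable-stable; from-yes)
open import Relation.Unary using (Decidable)

atomTag : Atom → ℕ
atomTag (base _) = 0
atomTag (gen _)  = 1
atomTag (loc _)  = 2

conceptTag : Concept → ℕ
conceptTag (atm _)    = 0
conceptTag (neg _)    = 1
conceptTag (_ ⊓ _)    = 2
conceptTag (ex _ _)   = 3
conceptTag (ιl _)     = 4
conceptTag (ιg _ _)   = 5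

assertionTag : Assertion → ℕ
assertionTag (_ ∶ _)     = 0
assertionTag (rel _ _ _) = 1
assertionTag ⊥ₐ          = 2

-- The omitted off-diagonal clauses of the ≟-sameTag functions are
-- refuted by their tag equation.
mutual
  _≟ᵃ_ : DecidableEquality Atom
  A ≟ᵃ A′ with atomTag A ≟ℕ atomTag A′
  ... | yes same  = ≟ᵃ-sameTag A A′ same
  ... | no differ = no (differ ∘ cong atomTag)

  ≟ᵃ-sameTag : ∀ A A′ → atomTag A ≡ atomTag A′ → Dec (A ≡ A′)
  ≟ᵃ-sameTag (base m) (base n) _ = map′ (cong base) (λ { refl → refl }) (m ≟ℕ n)
  ≟ᵃ-sameTag (gen C)  (gen D)  _ = map′ (cong gen) (λ { refl → refl }) (C ≟ᶜ D)
  ≟ᵃ-sameTag (loc C)  (loc D)  _ = map′ (cong loc) (λ { refl → refl }) (C ≟ᶜ D)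

  _≟ᶜ_ : DecidableEquality Concept
  C ≟ᶜ D with conceptTag C ≟ℕ conceptTag D
  ... | yes same  = ≟ᶜ-sameTag C D same
  ... | no differ = no (differ ∘ cong conceptTag)

  ≟ᶜ-sameTag : ∀ C D → conceptTag C ≡ conceptTag D → Dec (C ≡ D)
  ≟ᶜ-sameTag (atm A) (atm A′) _ = map′ (cong atm) (λ { refl → refl }) (A ≟ᵃ A′)
  ≟ᶜ-sameTag (neg C) (neg D)  _ = map′ (cong neg) (λ { refl → refl }) (C ≟ᶜ D)
  ≟ᶜ-sameTag (C ⊓ C′) (D ⊓ D′) _ =
    map′ (uncurry (cong₂ _⊓_)) (λ { refl → refl , refl }) (C ≟ᶜ D ×-dec C′ ≟ᶜ D′)
  ≟ᶜ-sameTag (ex r C) (ex s D) _ =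
    map′ (uncurry (cong₂ ex)) (λ { refl → refl , refl }) (r ≟ℕ s ×-dec C ≟ᶜ D)
  ≟ᶜ-sameTag (ιl C) (ιl D) _ = map′ (cong ιl) (λ { refl → refl }) (C ≟ᶜ D)
  ≟ᶜ-sameTag (ιg C C′) (ιg D D′) _ =
    map′ (uncurry (cong₂ ιg)) (λ { refl → refl , refl }) (C ≟ᶜ D ×-dec C′ ≟ᶜ D′)

≟ₐ-sameTag : ∀ α β → assertionTag α ≡ assertionTag β → Dec (α ≡ β)
≟ₐ-sameTag (x ∶ C) (y ∶ D) _ =
  map′ (uncurry (cong₂ _∶_)) (λ { refl → refl , refl }) (x ≟ℕ y ×-dec C ≟ᶜ D)
≟ₐ-sameTag (rel r x y) (rel s x′ y′) _ =
  map′ (λ { (refl , refl , refl) → refl }) (λ { refl → refl , refl , refl })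
       (r ≟ℕ s ×-dec x ≟ℕ x′ ×-dec y ≟ℕ y′)
≟ₐ-sameTag ⊥ₐ ⊥ₐ _ = yes refl

_≟ₐ_ : DecidableEquality Assertion
α ≟ₐ β with assertionTag α ≟ℕ assertionTag β
... | yes same  = ≟ₐ-sameTag α β same
... | no differ = no (differ ∘ cong assertionTag)

open import Data.List.Membership.DecPropositional _≟ₐ_ using (_∈?_)

module Acquisition {S K : Set}
  (_≼_ : S → S → Set) (≼-trans : ∀ {s t u} → s ≼ t → t ≼ u → s ≼ u)
  (Holds : S → K → Set) (Holds-mono : ∀ {s t k} → s ≼ t → Holds s k → Holds t k)
  where

  Acquires : List K → S → S → Set
  Acquires U t s = s ≼ t × Any (λ k → Holds t k × ¬ Holds s k) U

  acquires-from-below : ∀ {U s s′ t} → s ≼ s′ → Acquires U t s′ → Acquires U t s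
  acquires-from-below s≼s′ (s′≼t , new) =
    ≼-trans s≼s′ s′≼t , Any.map (λ (holds , ¬holds) → holds , ¬holds ∘ Holds-mono s≼s′) new

  acc-upward : ∀ {U s s′} → s ≼ s′ → Acc (Acquires U) s → Acc (Acquires U) s′
  acc-upward s≼s′ (acc rec) = acc (rec ∘ acquires-from-below s≼s′)

  acc-∷-holding : ∀ {U k s} → Holds s k → Acc (Acquires U) s → Acc (Acquires (k ∷ U)) s
  acc-∷-holding holds (acc rec) = acc λ where
    (_   , here (_ , ¬holds)) → ⊥-elim (¬holds holds)
    (s≼t , there new)         → acc-∷-holding (Holds-mono s≼t holds) (rec (s≼t , new))

  -- Since k keeps holding once acquired, it is acquired at most once.
  acc-∷ : ∀ {U k s} → Acc (Acquires U) s → Acc (Acquires (k ∷ U)) s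
  acc-∷ (acc rec) = acc λ where
    (s≼t , here (holds , _)) → acc-∷-holding holds (acc-upward s≼t (acc rec))
    (s≼t , there new)        → acc-∷ (rec (s≼t , new))

  acquires-wellFounded : ∀ U → WellFounded (Acquires U)
  acquires-wellFounded []      _ = acc λ { (_ , ()) }
  acquires-wellFounded (_ ∷ U) s = acc-∷ (acquires-wellFounded U s)

module AssertionGain = Acquisition {S = Branch} _⊆_ ⊆-trans (λ B α → α ∈ B) (λ B⊆B′ → B⊆B′)

sublists : {A : Set} → List A → List (List A)
sublists []       = [] ∷ []
sublists (x ∷ xs) = map (x ∷_) (sublists xs) ++ sublists xs

filter∈sublists : {A : Set} {P : A → Set} (barred? : Decidable P) (xs : List A) →
                  filter barred? xs ∈ sublists xs
filter∈sublists barred? [] = here refl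
filter∈sublists barred? (x ∷ xs) with does (barred? x)
... | true  = ∈-++⁺ˡ (∈-map⁺ (x ∷_) (filter∈sublists barred? xs))
... | false = ∈-++⁺ʳ (map (x ∷_) (sublists xs)) (filter∈sublists barred? xs)

subconcepts : Concept → List Concept
subconcepts (atm A)  = atm A ∷ []
subconcepts (neg C)  = neg C ∷ subconcepts C
subconcepts (C ⊓ D)  = C ⊓ D ∷ subconcepts C ++ subconcepts D
subconcepts (ex r C) = ex r C ∷ subconcepts C
subconcepts (ιl C)   = ιl C ∷ subconcepts C
subconcepts (ιg C D) = ιg C D ∷ subconcepts C ++ subconcepts D

subconcepts-refl : ∀ C → C ∈ subconcepts C
subconcepts-refl (atm _)  = here refl
subconcepts-refl (neg _)  = here refl
subconcepts-refl (_ ⊓ _)  = here refl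
subconcepts-refl (ex _ _) = here refl
subconcepts-refl (ιl _)   = here refl
subconcepts-refl (ιg _ _) = here refl

mutual
  subconcepts-trans : ∀ Z {Y X} → Y ∈ subconcepts Z → X ∈ subconcepts Y → X ∈ subconcepts Z
  subconcepts-trans (atm _)  (here refl) q = q
  subconcepts-trans (neg _)  (here refl) q = q
  subconcepts-trans (_ ⊓ _)  (here refl) q = q
  subconcepts-trans (ex _ _) (here refl) q = q
  subconcepts-trans (ιl _)   (here refl) q = q
  subconcepts-trans (ιg _ _) (here refl) q = q
  subconcepts-trans (neg Z)  (there p) q = there (subconcepts-trans Z p q)
  subconcepts-trans (ex _ Z) (there p) q = there (subconcepts-trans Z p q)
  subconcepts-trans (ιl Z)   (there p) q = there (subconcepts-trans Z p q)
  subconcepts-trans (Z ⊓ W)  (there p) q = there (subconcepts-++-trans Z W p q)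
  subconcepts-trans (ιg Z W) (there p) q = there (subconcepts-++-trans Z W p q)

  subconcepts-++-trans : ∀ Z W {Y X} → Y ∈ subconcepts Z ++ subconcepts W →
                         X ∈ subconcepts Y → X ∈ subconcepts Z ++ subconcepts W
  subconcepts-++-trans Z W p q with ∈-++⁻ (subconcepts Z) p
  ... | inj₁ p′ = ∈-++⁺ˡ (subconcepts-trans Z p′ q)
  ... | inj₂ p′ = ∈-++⁺ʳ (subconcepts Z) (subconcepts-trans W p′ q)

neg-sub : ∀ {C} → C ∈ subconcepts (neg C)
neg-sub {C} = there (subconcepts-refl C)

⊓-sub₁ : ∀ {C D} → C ∈ subconcepts (C ⊓ D)
⊓-sub₁ {C} = there (∈-++⁺ˡ (subconcepts-refl C))

⊓-sub₂ : ∀ {C D} → D ∈ subconcepts (C ⊓ D)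
⊓-sub₂ {C} {D} = there (∈-++⁺ʳ (subconcepts C) (subconcepts-refl D))

ex-sub : ∀ {r C} → C ∈ subconcepts (ex r C)
ex-sub {C = C} = there (subconcepts-refl C)

ιl-sub : ∀ {C} → C ∈ subconcepts (ιl C)
ιl-sub {C} = there (subconcepts-refl C)

ιg-sub₁ : ∀ {C D} → C ∈ subconcepts (ιg C D)
ιg-sub₁ {C} = there (∈-++⁺ˡ (subconcepts-refl C))

ιg-sub₂ : ∀ {C D} → D ∈ subconcepts (ιg C D)
ιg-sub₂ {C} {D} = there (∈-++⁺ʳ (subconcepts C) (subconcepts-refl D))

Compound : Concept → Set
Compound (atm _) = ⊥
Compound (neg _) = ⊥
Compound _       = ⊤

module Termination (O : Ontology) (C₀ : Concept) where

  _⟵_ : Branch → Branch → Set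
  B′ ⟵ B = B′ ⟵[ O ] B

  inclusionConcept : Concept × Concept → Concept
  inclusionConcept (C , D) = neg (C ⊓ neg D)

  roots : List Concept
  roots = C₀ ∷ map inclusionConcept (TBox O) ++ map proj₂ (ABoxC O)

  InClosure : Concept → Set
  InClosure X = Σ Concept λ R → R ∈ roots × X ∈ subconcepts R

  root-in-closure : ∀ {R} → R ∈ roots → InClosure R
  root-in-closure {R} R∈ = R , R∈ , subconcepts-refl R

  closure-sub : ∀ {X Y} → InClosure X → Y ∈ subconcepts X → InClosure Y
  closure-sub (R , R∈ , X∈) Y∈ = R , R∈ , subconcepts-trans R X∈ Y∈

  closure : List Concept
  closure = concatMap subconcepts roots

  InClosure⇒∈closure : ∀ {X} → InClosure X → X ∈ closure
  InClosure⇒∈closure (R , R∈ , X∈) = ∈-concatMap⁺ subconcepts (lose R∈ X∈)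

  data Admissible : Concept → Set where
    closed       : ∀ {D} → InClosure D → Admissible D
    negClosed    : ∀ {D} → InClosure D → Admissible (neg D)
    genMarker    : ∀ {D} → InClosure D → Admissible (atm (gen D))
    negGenMarker : ∀ {D} → InClosure D → Admissible (neg (atm (gen D)))
    locMarker    : ∀ {D} → InClosure D → Admissible (atm (loc D))
    negLocMarker : ∀ {D} → InClosure D → Admissible (neg (atm (loc D)))

  literals : Concept → List Concept
  literals D = D ∷ neg D ∷ atm (gen D) ∷ neg (atm (gen D)) ∷ atm (loc D) ∷ neg (atm (loc D)) ∷ []

  admissibles : List Concept
  admissibles = concatMap literals closure

  literal∈admissibles : ∀ {D X} → InClosure D → X ∈ literals D → X ∈ admissibles
  literal∈admissibles p X∈ = ∈-concatMap⁺ literals (lose (InClosure⇒∈closure p) X∈)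

  Admissible⇒∈admissibles : ∀ {X} → Admissible X → X ∈ admissibles
  Admissible⇒∈admissibles (closed p)       = literal∈admissibles p (here refl)
  Admissible⇒∈admissibles (negClosed p)    = literal∈admissibles p (there (here refl))
  Admissible⇒∈admissibles (genMarker p)    =
    literal∈admissibles p (there (there (here refl)))
  Admissible⇒∈admissibles (negGenMarker p) =
    literal∈admissibles p (there (there (there (here refl))))
  Admissible⇒∈admissibles (locMarker p)    =
    literal∈admissibles p (there (there (there (there (here refl)))))
  Admissible⇒∈admissibles (negLocMarker p) =
    literal∈admissibles p (there (there (there (there (there (here refl))))))

  compound-closed : ∀ {X} → Admissible X → Compound X → InClosure X
  compound-closed (closed p) _ = p

  negated-compound-closed : ∀ {X} → Admissible (neg X) → Compound X → InClosure X
  negated-compound-closed (closed p)    _ = closure-sub p neg-sub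
  negated-compound-closed (negClosed p) _ = p

  AdmissibleAssertion : Assertion → Set
  AdmissibleAssertion (_ ∶ D)     = Admissible D
  AdmissibleAssertion (rel _ _ _) = ⊤
  AdmissibleAssertion ⊥ₐ          = ⊤

  AdmissibleBranch : Branch → Set
  AdmissibleBranch = All AdmissibleAssertion

  closed-below : ∀ {B x X Y} → AdmissibleBranch B → (x ∶ X) ∈ B → Compound X →
                 Y ∈ subconcepts X → InClosure Y
  closed-below adm x∈ compound = closure-sub (compound-closed (All.lookup adm x∈) compound)

  closed-below-neg : ∀ {B x X Y} → AdmissibleBranch B → (x ∶ neg X) ∈ B → Compound X →
                     Y ∈ subconcepts X → InClosure Y
  closed-below-neg adm x∈ compound =
    closure-sub (negated-compound-closed (All.lookup adm x∈) compound)

  conclusions-admissible : ∀ {B r Cs} → AdmissibleBranch B → App O B r Cs →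
                           All (All AdmissibleAssertion) Cs
  conclusions-admissible _ (aboxI m) =
    (closed (root-in-closure (there (∈-++⁺ʳ _ (∈-map⁺ proj₂ m)))) ∷ []) ∷ []
  conclusions-admissible _ (aboxR _) = (tt ∷ []) ∷ []
  conclusions-admissible _ (tbox m _) =
    (closed (root-in-closure (there (∈-++⁺ˡ (∈-map⁺ inclusionConcept m)))) ∷ []) ∷ []
  conclusions-admissible _ (bot _ _) = (tt ∷ []) ∷ []
  conclusions-admissible adm (negneg m) with All.lookup adm m
  ... | closed p    = (closed (closure-sub (closure-sub p neg-sub) neg-sub) ∷ []) ∷ []
  ... | negClosed p = (closed (closure-sub p neg-sub) ∷ []) ∷ []
  conclusions-admissible adm (and m) =
    (closed (closed-below adm m _ ⊓-sub₁) ∷ closed (closed-below adm m _ ⊓-sub₂) ∷ []) ∷ []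
  conclusions-admissible adm (nand m) =
    (negClosed (closed-below-neg adm m _ ⊓-sub₁) ∷ [])
    ∷ (negClosed (closed-below-neg adm m _ ⊓-sub₂) ∷ []) ∷ []
  conclusions-admissible adm (exR m _ _) = (closed (closed-below adm m _ ex-sub) ∷ tt ∷ []) ∷ []
  conclusions-admissible adm (nex m _) = (negClosed (closed-below-neg adm m _ ex-sub) ∷ []) ∷ []
  conclusions-admissible adm (ιg1-new m _ _) =
    (closed (closed-below adm m _ ιg-sub₁) ∷ closed (closed-below adm m _ ιg-sub₂) ∷ []) ∷ []
  conclusions-admissible adm (ιg1-old m _) = (closed (closed-below adm m _ ιg-sub₂) ∷ []) ∷ []
  conclusions-admissible adm (ιg2 _ _ _ m) = (All.lookup adm m ∷ []) ∷ []
  conclusions-admissible adm (nιg {C = C} m _ _ _ _ _) =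
    (negClosed c ∷ []) ∷ (negClosed (closed-below-neg adm m _ ιg-sub₂) ∷ [])
    ∷ (closed c ∷ genMarker c ∷ closed c ∷ negGenMarker c ∷ []) ∷ []
    where
    c : InClosure C
    c = closed-below-neg adm m _ ιg-sub₁
  conclusions-admissible adm (cutg m _) =
    (closed (closed-below adm m _ ιg-sub₁) ∷ [])
    ∷ (negClosed (closed-below adm m _ ιg-sub₁) ∷ []) ∷ []
  conclusions-admissible adm (ιl1 m) = (closed (closed-below adm m _ ιl-sub) ∷ []) ∷ []
  conclusions-admissible adm (ιl2 _ _ _ m) = (All.lookup adm m ∷ []) ∷ []
  conclusions-admissible adm (nιl-new {C = C} m _ _) =
    (negClosed c ∷ []) ∷ (negLocMarker c ∷ closed c ∷ locMarker c ∷ []) ∷ []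
    where
    c : InClosure C
    c = closed-below-neg adm m _ ιl-sub
  conclusions-admissible adm (nιl-old m _ _) =
    (negClosed (closed-below-neg adm m _ ιl-sub) ∷ [])
    ∷ (negLocMarker (closed-below-neg adm m _ ιl-sub) ∷ []) ∷ []
  conclusions-admissible adm (cutl m _) =
    (closed (closed-below adm m _ ιl-sub) ∷ [])
    ∷ (negClosed (closed-below adm m _ ιl-sub) ∷ []) ∷ []

  step-extends : ∀ {B B′} → B′ ⟵ B → B ⊆ B′
  step-extends (_ , _ , _ , _ , chosen) with find chosen
  ... | Con , _ , refl = xs⊆ys++xs _ Con

  step-admissible : ∀ {B B′} → AdmissibleBranch B → B′ ⟵ B → AdmissibleBranch B′
  step-admissible adm (_ , _ , (app , _) , _ , chosen) with find chosen
  ... | _ , Con∈Cs , refl = Allₚ.++⁺ (All.lookup (conclusions-admissible adm app) Con∈Cs) adm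

  data Key : Set where
    witness   : Concept → List Concept → Key
    inhabited : Concept → Key
    located   : Concept → Key

  -- The second disjunct lets the individual b created by (∃r) on a:∃r.C
  -- witness its key as soon as r(a,b) is added; conversely, the priority
  -- of (¬∃r) over (∃r) puts x:¬D on the branch whenever it is excluded in
  -- this way (on-branch-if-excluded).
  Excluded : Branch → Ind → Concept → Set
  Excluded B x D =
    (x ∶ neg D) ∈ B ⊎ Σ Ind λ y → Σ Role λ r → rel r y x ∈ B × (y ∶ neg (ex r D)) ∈ B

  Holds : Branch → Key → Set
  Holds B (witness C S) = Σ Ind λ x → (x ∶ C) ∈ B × All (Excluded B x) S
  Holds B (inhabited C) = Σ Ind λ x → (x ∶ C) ∈ B
  Holds B (located C)   = Σ Ind λ x → (x ∶ C) ∈ B × (x ∶ atm (loc C)) ∈ B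

  Holds-mono : ∀ {B B′ k} → B ⊆ B′ → Holds B k → Holds B′ k
  Holds-mono {k = witness C S} B⊆B′ (x , x∈ , excluded) =
    x , B⊆B′ x∈ , All.map (Sum.map B⊆B′ λ (y , r , edge , y∈) → y , r , B⊆B′ edge , B⊆B′ y∈)
                          excluded
  Holds-mono {k = inhabited C} B⊆B′ (x , x∈)        = x , B⊆B′ x∈
  Holds-mono {k = located C}   B⊆B′ (x , x∈ , loc∈) = x , B⊆B′ x∈ , B⊆B′ loc∈

  module KeyGain = Acquisition _⊆_ ⊆-trans Holds Holds-mono

  witnessKeys : List Key
  witnessKeys = concatMap (λ C → map (witness C) (sublists closure)) closure

  keys : List Key
  keys = witnessKeys ++ map inhabited admissibles ++ map located closure

  witness∈keys : ∀ {C S} → InClosure C → S ∈ sublists closure → witness C S ∈ keys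
  witness∈keys {C} c S∈ =
    ∈-++⁺ˡ (∈-concatMap⁺ _ (lose (InClosure⇒∈closure c) (∈-map⁺ (witness C) S∈)))

  inhabited∈keys : ∀ {C} → Admissible C → inhabited C ∈ keys
  inhabited∈keys c =
    ∈-++⁺ʳ witnessKeys (∈-++⁺ˡ (∈-map⁺ inhabited (Admissible⇒∈admissibles c)))

  located∈keys : ∀ {C} → InClosure C → located C ∈ keys
  located∈keys c =
    ∈-++⁺ʳ witnessKeys (∈-++⁺ʳ _ (∈-map⁺ located (InClosure⇒∈closure c)))

  Known : Branch → Ind → Set
  Known B x = Any (Occ x) B ⊎ OccursO x O

  Old : Branch → Assertion → Set
  Old B (x ∶ _)     = Known B x
  Old B (rel r x y) = (r , x , y) ∈ ABoxR O
  Old B ⊥ₐ          = ⊤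

  on-branch : ∀ {B x D} → (x ∶ D) ∈ B → Known B x
  on-branch x∈ = inj₁ (lose x∈ refl)

  data StepKind (B : Branch) : Branch → Set where
    newKey  : ∀ {B′} → KeyGain.Acquires keys B′ B → StepKind B B′
    reusing : ∀ {Con} → ¬ All (_∈ B) Con → All (Old B) Con → StepKind B (Con ++ B)

  acquiring : ∀ {B} Con {k} → k ∈ keys → Holds (Con ++ B) k → ¬ Holds B k → StepKind B (Con ++ B)
  acquiring Con k∈ holds ¬holds = newKey (xs⊆ys++xs _ Con , lose k∈ (holds , ¬holds))

  ∃-acquires : ∀ {B a r C b} → AdmissibleBranch B → ¬ ⊥ₐ ∈ B →
               (∀ r′ Cs′ → rank r′ < rank R∃ → ¬ Applicable O B r′ Cs′) →
               (a ∶ ex r C) ∈ B → ¬ ∃Blocked B a r C → StepKind B (b ∶ C ∷ rel r a b ∷ B)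
  ∃-acquires {B} {a} {r} {C} {b} adm ⊥∉B prior a∈ unblocked =
    acquiring _
      (witness∈keys (closed-below adm a∈ _ ex-sub) (filter∈sublists barred? closure))
      (b , here refl , All.tabulate through-edge)
      λ (x , x∈ , excluded) → unblocked (x , x∈ , λ D D∈ →
        on-branch-if-excluded (All.lookup excluded (∈-filter⁺ barred? (in-closure D∈) D∈)))
    where
    barred? : Decidable λ D → (a ∶ neg (ex r D)) ∈ B
    barred? D = (a ∶ neg (ex r D)) ∈? B

    in-closure : ∀ {D} → (a ∶ neg (ex r D)) ∈ B → D ∈ closure
    in-closure D∈ = InClosure⇒∈closure (closed-below-neg adm D∈ _ ex-sub)

    through-edge : ∀ {D} → D ∈ filter barred? closure → Excluded (b ∶ C ∷ rel r a b ∷ B) b D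
    through-edge D∈ =
      inj₂ (a , r , there (here refl) , there (there (proj₂ (∈-filter⁻ barred? {xs = closure} D∈))))

    on-branch-if-excluded : ∀ {x D} → Excluded B x D → (x ∶ neg D) ∈ B
    on-branch-if-excluded (inj₁ x∈) = x∈
    on-branch-if-excluded (inj₂ (_ , _ , edge , y∈)) = decidable-stable (_ ∈? B) λ x∉ →
      prior R¬∃ _ (from-yes (7 <? 16)) (nex y∈ edge , ⊥∉B , (λ { (x∈ ∷ []) → x∉ x∈ }) ∷ [])

  reusing-individual : ∀ {B x D E} → (x ∶ D) ∈ B → ¬ All (_∈ B) (x ∶ E ∷ []) →
                       StepKind B (x ∶ E ∷ B)
  reusing-individual x∈ new = reusing new (on-branch x∈ ∷ [])

  classify : ∀ {B B′} → AdmissibleBranch B → B′ ⟵ B → StepKind B B′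
  classify _ (_ , _ , (aboxI m , _ , new ∷ []) , _ , here refl) =
    reusing new (inj₂ (inj₁ (lose m refl)) ∷ [])
  classify _ (_ , _ , (aboxR m , _ , new ∷ []) , _ , here refl) = reusing new (m ∷ [])
  classify _ (_ , _ , (bot _ _ , _ , new ∷ []) , _ , here refl) = reusing new (tt ∷ [])
  classify _ (_ , _ , (and m , _ , new ∷ []) , _ , here refl) =
    reusing new (on-branch m ∷ on-branch m ∷ [])
  classify _ (_ , _ , (nex _ edge , _ , new ∷ []) , _ , here refl) =
    reusing new (inj₁ (lose edge (inj₂ refl)) ∷ [])
  classify _ (_ , _ , (tbox _ m , _ , new ∷ []) , _ , here refl) = reusing-individual m new
  classify _ (_ , _ , (negneg m , _ , new ∷ []) , _ , here refl) = reusing-individual m new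
  classify _ (_ , _ , (nand m , _ , new ∷ _) , _ , here refl) = reusing-individual m new
  classify _ (_ , _ , (nand m , _ , _ ∷ new ∷ _) , _ , there (here refl)) = reusing-individual m new
  classify _ (_ , _ , (ιg1-old _ (m , _) , _ , new ∷ []) , _ , here refl) = reusing-individual m new
  classify _ (_ , _ , (ιg2 _ _ m _ , _ , new ∷ []) , _ , here refl) = reusing-individual m new
  classify _ (_ , _ , (nιg _ m _ _ _ _ , _ , new ∷ _) , _ , here refl) = reusing-individual m new
  classify _ (_ , _ , (nιg _ m _ _ _ _ , _ , _ ∷ new ∷ _) , _ , there (here refl)) =
    reusing-individual m new
  classify _ (_ , _ , (cutg _ m , _ , new ∷ _) , _ , here refl) = reusing-individual m new
  classify _ (_ , _ , (cutg _ m , _ , _ ∷ new ∷ _) , _ , there (here refl)) =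
    reusing-individual m new
  classify _ (_ , _ , (ιl1 m , _ , new ∷ []) , _ , here refl) = reusing-individual m new
  classify _ (_ , _ , (ιl2 _ _ m _ , _ , new ∷ []) , _ , here refl) = reusing-individual m new
  classify _ (_ , _ , (nιl-new m _ _ , _ , new ∷ _) , _ , here refl) = reusing-individual m new
  classify _ (_ , _ , (nιl-old m _ _ , _ , new ∷ _) , _ , here refl) = reusing-individual m new
  classify _ (_ , _ , (nιl-old m _ _ , _ , _ ∷ new ∷ _) , _ , there (here refl)) =
    reusing-individual m new
  classify _ (_ , _ , (cutl _ m , _ , new ∷ _) , _ , here refl) = reusing-individual m new
  classify _ (_ , _ , (cutl _ m , _ , _ ∷ new ∷ _) , _ , there (here refl)) =
    reusing-individual m new
  classify adm (_ , _ , (ιg1-new m none _ , _) , _ , here refl) =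
    acquiring _ (inhabited∈keys (closed (closed-below adm m _ ιg-sub₁)))
      (_ , here refl) λ (x , x∈) → none x x∈
  classify adm (_ , _ , (nιg m _ unblocked _ _ _ , _) , _ , there (there (here refl))) =
    acquiring _ (inhabited∈keys (genMarker (closed-below-neg adm m _ ιg-sub₁)))
      (_ , there (here refl)) unblocked
  classify adm (_ , _ , (nιl-new m none _ , _) , _ , there (here refl)) =
    acquiring _ (located∈keys (closed-below-neg adm m _ ιl-sub))
      (_ , there (here refl) , there (there (here refl))) none
  classify adm (_ , _ , (exR m _ unblocked , ⊥∉B , _) , prior , here refl) =
    ∃-acquires adm ⊥∉B prior m unblocked

  relAssertion : Role × Ind × Ind → Assertion
  relAssertion (r , x , y) = rel r x y

  candidates : List Ind → List Assertion
  candidates I = ⊥ₐ ∷ cartesianProductWith _∶_ I admissibles ++ map relAssertion (ABoxR O)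

  Covers : List Ind → Branch → Set
  Covers I B = ∀ {x} → Known B x → x ∈ I

  old-candidate : ∀ {I B α} → Covers I B → AdmissibleAssertion α → Old B α → α ∈ candidates I
  old-candidate {α = _ ∶ _} covers adm known =
    there (∈-++⁺ˡ (∈-cartesianProductWith⁺ _∶_ (covers known) (Admissible⇒∈admissibles adm)))
  old-candidate {α = rel _ _ _} _ _ r∈ = there (∈-++⁺ʳ _ (∈-map⁺ relAssertion r∈))
  old-candidate {α = ⊥ₐ} _ _ _ = here refl

  old-known : ∀ {B α x} → Old B α → Occ x α → Known B x
  old-known {α = _ ∶ _}     known refl        = known
  old-known {α = rel _ _ _} r∈    (inj₁ refl) = inj₂ (inj₂ (lose r∈ (inj₁ refl)))
  old-known {α = rel _ _ _} r∈    (inj₂ refl) = inj₂ (inj₂ (lose r∈ (inj₂ refl)))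

  covers-reusing : ∀ {I B Con} → Covers I B → All (Old B) Con → Covers I (Con ++ B)
  covers-reusing covers _ (inj₂ inO) = covers (inj₂ inO)
  covers-reusing {Con = Con} covers olds (inj₁ occurs) with Anyₚ.++⁻ Con occurs
  ... | inj₂ inB = covers (inj₁ inB)
  ... | inj₁ inCon with find inCon
  ... | _ , α∈ , occ = covers (old-known (All.lookup olds α∈) occ)

  occurring : Assertion → List Ind
  occurring (x ∶ _)     = x ∷ []
  occurring (rel _ x y) = x ∷ y ∷ []
  occurring ⊥ₐ          = []

  Occ⇒∈occurring : ∀ {x} α → Occ x α → x ∈ occurring α
  Occ⇒∈occurring (_ ∶ _)     refl        = here refl
  Occ⇒∈occurring (rel _ _ _) (inj₁ refl) = here refl
  Occ⇒∈occurring (rel _ _ _) (inj₂ refl) = there (here refl)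

  individuals : Branch → List Ind
  individuals B = concatMap occurring B
               ++ map proj₁ (ABoxC O) ++ concatMap (occurring ∘ relAssertion) (ABoxR O)

  covers-individuals : ∀ {B} → Covers (individuals B) B
  covers-individuals (inj₁ occurs) =
    ∈-++⁺ˡ (∈-concatMap⁺ occurring (Any.map (λ {α} → Occ⇒∈occurring α) occurs))
  covers-individuals {B} (inj₂ (inj₁ inABoxC)) =
    ∈-++⁺ʳ (concatMap occurring B) (∈-++⁺ˡ (Anyₚ.map⁺ (Any.map sym inABoxC)))
  covers-individuals {B} (inj₂ (inj₂ inABoxR)) =
    ∈-++⁺ʳ (concatMap occurring B) (∈-++⁺ʳ _ (∈-concatMap⁺ (occurring ∘ relAssertion)
      (Any.map (λ {t} occ → Occ⇒∈occurring (relAssertion t) (Sum.map sym sym occ)) inABoxR)))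

  KeyAcc : Branch → Set
  KeyAcc = Acc (KeyGain.Acquires keys)

  CandidateAcc : List Ind → Branch → Set
  CandidateAcc I = Acc (AssertionGain.Acquires (candidates I))

  -- Key accessibility is kept at the branch B₀ where I was last fixed, so
  -- that both recursive calls are structural (on KeyAcc, then CandidateAcc).
  mutual
    terminates : ∀ {B₀ B I} → KeyAcc B₀ → B₀ ⊆ B → AdmissibleBranch B → Covers I B →
                 CandidateAcc I B → Acc _⟵_ B
    terminates keyAcc B₀⊆B adm covers candAcc =
      acc λ step → terminates-after keyAcc B₀⊆B adm covers candAcc step (classify adm step)

    terminates-after : ∀ {B₀ B B′ I} → KeyAcc B₀ → B₀ ⊆ B → AdmissibleBranch B → Covers I B →
                       CandidateAcc I B → B′ ⟵ B → StepKind B B′ → Acc _⟵_ B′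
    terminates-after (acc keyRec) B₀⊆B adm _ _ step (newKey gain) =
      terminates (keyRec (KeyGain.acquires-from-below B₀⊆B gain)) ⊆-refl
        (step-admissible adm step) covers-individuals (AssertionGain.acquires-wellFounded _ _)
    terminates-after {B = B} {I = I} keyAcc B₀⊆B adm covers (acc candRec) step
                     (reusing {Con} new olds) =
      terminates keyAcc (⊆-trans B₀⊆B B⊆B′) adm′ (covers-reusing covers olds)
        (candRec (B⊆B′ , gained))
      where
      B⊆B′ : B ⊆ Con ++ B
      B⊆B′ = step-extends step
      adm′ : AdmissibleBranch (Con ++ B)
      adm′ = step-admissible adm step
      gained : Any (λ α → α ∈ Con ++ B × ¬ α ∈ B) (candidates I)
      gained with find (Allₚ.¬All⇒Any¬ (_∈? B) Con new)
      ... | α , α∈ , α∉ =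
        lose (old-candidate covers (All.lookup adm′ (∈-++⁺ˡ α∈)) (All.lookup olds α∈))
             (∈-++⁺ˡ α∈ , α∉)

theorem8 : (O : Ontology) (C : Concept) (a : Ind) →
    PureO O → PureC C → ¬ OccursO a O → Terminates O a C
theorem8 O C a _ _ _ =
  terminates (KeyGain.acquires-wellFounded keys root) ⊆-refl
    (closed (root-in-closure (here refl)) ∷ []) covers-individuals
    (AssertionGain.acquires-wellFounded _ root)
  where
  open Termination O C
  root : Branch
  root = a ∶ C ∷ []
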